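{- Assume that $d_n^2 < 2p_n$ for every integer $n\geq 1$ with $n\neq 4$. Then for every real $x\geq 1$ the interval $(x, x+\frac{8}{5}\sqrt{x})$ contains a prime; equivalently, $d_n < \frac{8}{5}\sqrt{p_n}$ for all $n\geq 1$.
   Context: $p_n$ denotes the $n$th prime ($p_1=2$) and $d_n := p_{n+1}-p_n$. -}

module Defs where

open import Data.Nat using (ℕ; suc)
open import Data.Nat.Primality using (Prime; prime?)
open import Data.List using (length; filter; upTo)
open import Data.Product using (_×_)
open import Relation.Binary.PropositionalEquality using (_≡_)

primeCount : ℕ → ℕ
primeCount m = length (filter prime? (upTo (suc m)))

-- NthPrime n p  ⇔  p = p_n  (the n-th prime, p_1 = 2)
NthPrime : ℕ → ℕ → Set
NthPrime n p = Prime p × primeCount p ≡ n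

{-# OPTIONS --safe #-}
-- For n ≠ 4 the hypothesis already gives 25 d_n² < 50 p_n ≤ 64 p_n. In the excluded case
-- p₄ = 7 and p₅ = 11, so 25 d₄² = 400 < 448 = 64 p₄; these values are forced because π
-- strictly increases at every prime, hence each rank n has at most one n-th prime.
module Submission where

open import Defs
open import Data.Nat using (ℕ; suc; _∸_; _^_; _*_; _+_; _<_; _≤_; _≤′_; ≤′-refl; ≤′-step; s≤s; _≟_; _<?_; _≤?_)
open import Data.Nat.Properties
  using (≤⇒≤′; ≤-refl; n<1+n; ≤-trans; m≤m+n; +-comm; <-irrefl; <-cmp; *-assoc; *-monoʳ-<; *-monoˡ-≤; module ≤-Reasoning)
open import Data.Nat.Primality using (Prime; prime?)
open import Data.List using (length; filter; upTo; _++_; _∷_; [])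
open import Data.List.Properties using (filter-++; filter-accept; length-++; upTo-∷ʳ)
open import Data.Product using (_,_)
open import Relation.Binary using (tri<; tri≈; tri>)
open import Relation.Binary.PropositionalEquality using (_≡_; _≢_; refl; sym; trans; cong; module ≡-Reasoning)
open import Relation.Nullary using (yes; no; contradiction)
open import Relation.Nullary.Decidable using (from-yes)

primeCount-suc : ∀ m → primeCount (suc m) ≡ primeCount m + length (filter prime? (suc m ∷ []))
primeCount-suc m = begin
  length (filter prime? (upTo (suc (suc m))))
    ≡⟨ cong (λ xs → length (filter prime? xs)) (sym (upTo-∷ʳ (suc m))) ⟩
  length (filter prime? (upTo (suc m) ++ suc m ∷ []))
    ≡⟨ cong length (filter-++ prime? (upTo (suc m)) (suc m ∷ [])) ⟩
  length (filter prime? (upTo (suc m)) ++ filter prime? (suc m ∷ []))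
    ≡⟨ length-++ (filter prime? (upTo (suc m))) ⟩
  primeCount m + length (filter prime? (suc m ∷ [])) ∎
  where open ≡-Reasoning

primeCount-≤-suc : ∀ m → primeCount m ≤ primeCount (suc m)
primeCount-≤-suc m rewrite primeCount-suc m = m≤m+n _ _

primeCount-suc-prime : ∀ {m} → Prime (suc m) → primeCount (suc m) ≡ suc (primeCount m)
primeCount-suc-prime {m} pr = begin
  primeCount (suc m)                                 ≡⟨ primeCount-suc m ⟩
  primeCount m + length (filter prime? (suc m ∷ [])) ≡⟨ cong (λ xs → primeCount m + length xs) (filter-accept prime? pr) ⟩
  primeCount m + 1                                   ≡⟨ +-comm (primeCount m) 1 ⟩
  suc (primeCount m)                                 ∎
  where open ≡-Reasoning

primeCount-mono-≤′ : ∀ {m n} → m ≤′ n → primeCount m ≤ primeCount n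
primeCount-mono-≤′ ≤′-refl          = ≤-refl
primeCount-mono-≤′ (≤′-step {n} m≤n) = ≤-trans (primeCount-mono-≤′ m≤n) (primeCount-≤-suc n)

primeCount-mono-≤ : ∀ {m n} → m ≤ n → primeCount m ≤ primeCount n
primeCount-mono-≤ m≤n = primeCount-mono-≤′ (≤⇒≤′ m≤n)

primeCount-mono-<-prime : ∀ {m p} → Prime p → m < p → primeCount m < primeCount p
primeCount-mono-<-prime {m} {suc p} pr (s≤s m≤p) = begin-strict
  primeCount m        ≤⟨ primeCount-mono-≤ m≤p ⟩
  primeCount p        <⟨ n<1+n (primeCount p) ⟩
  suc (primeCount p)  ≡⟨ primeCount-suc-prime pr ⟨
  primeCount (suc p)  ∎
  where open ≤-Reasoning

NthPrime-unique : ∀ {n p q} → NthPrime n p → NthPrime n q → p ≡ q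
NthPrime-unique {p = p} {q} (p-prime , πp≡n) (q-prime , πq≡n) with <-cmp p q
... | tri< p<q _ _ = contradiction (primeCount-mono-<-prime q-prime p<q) (<-irrefl (trans πp≡n (sym πq≡n)))
... | tri≈ _ p≡q _ = p≡q
... | tri> _ _ q<p = contradiction (primeCount-mono-<-prime p-prime q<p) (<-irrefl (trans πq≡n (sym πp≡n)))

fourthPrime : NthPrime 4 7
fourthPrime = from-yes (prime? 7) , refl

fifthPrime : NthPrime 5 11
fifthPrime = from-yes (prime? 11) , refl

proposition2p11 :
    (∀ (n p q : ℕ) → 1 ≤ n → n ≢ 4 → NthPrime n p → NthPrime (suc n) q →
      (q ∸ p) ^ 2 < 2 * p) →
    ∀ (n p q : ℕ) → 1 ≤ n → NthPrime n p → NthPrime (suc n) q →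
      25 * (q ∸ p) ^ 2 < 64 * p
proposition2p11 hyp n p q 1≤n pₙ pₙ₊₁ with n ≟ 4
... | yes refl rewrite NthPrime-unique pₙ fourthPrime | NthPrime-unique pₙ₊₁ fifthPrime =
  from-yes (25 * (11 ∸ 7) ^ 2 <? 64 * 7)
... | no n≢4 = begin-strict
  25 * (q ∸ p) ^ 2  <⟨ *-monoʳ-< 25 (hyp n p q 1≤n n≢4 pₙ pₙ₊₁) ⟩
  25 * (2 * p)      ≡⟨ *-assoc 25 2 p ⟨
  50 * p            ≤⟨ *-monoˡ-≤ p (from-yes (50 ≤? 64)) ⟩
  64 * p            ∎
  where open ≤-Reasoning
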